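{- Let $S$ be a skip graph with alphabet $\{0,1\}$, and consider a search from node $s$ to node $t$ in $S$. Let $u$ be a node with $s < u < t$ in the key ordering, and let $d$ be the number of nodes $v$ with $u < v \le t$. Then the probability that the search from $s$ to $t$ passes through $u$ is less than $\frac{2}{d+1}$.
   Context: Skip graph: a finite set of nodes with distinct keys from a totally ordered set; each node $x$ has a membership vector $m(x)\in\{0,1\}^\omega$ whose bits are independent and uniformly random. For each finite binary word $w$, $S_w$ is the list of nodes whose membership vector has prefix $w$, sorted by key; $w\upharpoonright i$ is the length-$i$ prefix of $w$. Search from $s$ to $t$ (with $s<t$): the search keeps a current node $v$ (initially $s$) and a current level $\ell$ (initially the least level at which $s$ is alone in $S_{m(s)\upharpoonright\ell}$); repeatedly, if the successor of $v$ in the list $S_{m(s)\upharpoonright \ell}$ exists and has key $\le t$, the search moves to that successor; otherwise, if $\ell>0$ it decreases $\ell$ by one, and if $\ell=0$ it stops. The search passes through $u$ if $u$ is one of the current nodes visited. The probability is over the random membership vectors. -}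

module Defs where

open import Data.Bool using (Bool; true; false; _∧_; not; if_then_else_)
open import Data.Bool.Properties using () renaming (_≟_ to _≟ᵇ_)
open import Data.Nat using (ℕ; zero; suc; _+_; _*_; _∸_; _≤ᵇ_; _<ᵇ_)
open import Data.Fin using (Fin; toℕ)
open import Data.Fin.Properties using () renaming (_≟_ to _≟ᶠ_)
open import Data.List using (List; []; _∷_; filter; length; allFin; map; concatMap; upTo)
open import Data.Bool.ListAction using (any)
open import Data.Maybe using (Maybe; just; nothing)
open import Data.Vec using (Vec; []; _∷_; lookup)
open import Relation.Nullary.Decidable using (⌊_⌋)
open import Data.Bool.Properties using (T?)

-- Nodes are Fin n; the key order is the order of indices (keys are distinct,
-- only their relative order matters).  A truncated membership assignment gives
-- every node the first L bits of its membership vector.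
Assignment : ℕ → ℕ → Set
Assignment n L = Vec (Vec Bool L) n

allBits : (L : ℕ) → List (Vec Bool L)
allBits zero = [] ∷ []
allBits (suc L) = concatMap (λ v → (false ∷ v) ∷ (true ∷ v) ∷ []) (allBits L)

allVecs : {A : Set} → List A → (k : ℕ) → List (Vec A k)
allVecs xs zero = [] ∷ []
allVecs xs (suc k) = concatMap (λ v → map (λ x → x ∷ v) xs) (allVecs xs k)

-- all assignments: 2^(n*L) of them, uniformly weighted
allAssignments : (n L : ℕ) → List (Assignment n L)
allAssignments n L = allVecs (allBits L) n

agree : {L : ℕ} → ℕ → Vec Bool L → Vec Bool L → Bool
agree zero _ _ = true
agree (suc ℓ) [] [] = true
agree (suc ℓ) (x ∷ xs) (y ∷ ys) = ⌊ x ≟ᵇ y ⌋ ∧ agree ℓ xs ys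

module Search {n L : ℕ} (m : Assignment n L) (s t : Fin n) where

  mv : Fin n → Vec Bool L
  mv x = lookup m x

  inList : ℕ → Fin n → Bool
  inList ℓ x = agree ℓ (mv x) (mv s)

  alone : ℕ → Bool
  alone ℓ = not (any (λ x → not ⌊ x ≟ᶠ s ⌋ ∧ inList ℓ x) (allFin n))

  startLevel : Maybe ℕ
  startLevel = first (upTo (suc L))
    where
    first : List ℕ → Maybe ℕ
    first [] = nothing
    first (ℓ ∷ ls) = if alone ℓ then just ℓ else first ls

  successor : ℕ → Fin n → Maybe (Fin n)
  successor ℓ v = least (allFin n)
    where
    least : List (Fin n) → Maybe (Fin n)
    least [] = nothing
    least (w ∷ ws) = if (toℕ v <ᵇ toℕ w) ∧ inList ℓ w then just w else least ws

  -- nodes visited by the search, run with fuel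
  -- (fuel n + L + 1 suffices: at most n-1 moves and at most L level decreases)
  visits : ℕ → Fin n → ℕ → List (Fin n)
  step : ℕ → Fin n → ℕ → Maybe (Fin n) → List (Fin n)
  down : ℕ → Fin n → ℕ → List (Fin n)
  visits zero v ℓ = v ∷ []
  visits (suc f) v ℓ = step f v ℓ (successor ℓ v)
  step f v ℓ (just w) = if toℕ w ≤ᵇ toℕ t then v ∷ visits f w ℓ else down f v ℓ
  step f v ℓ nothing = down f v ℓ
  down f v zero = v ∷ []
  down f v (suc ℓ') = v ∷ visits f v ℓ'

  -- the event: s is alone at some level ≤ L (so the search is determined by
  -- the first L bits) and the search from s to t passes through u
  passesThrough : Fin n → Bool
  passesThrough u with startLevel
  ... | nothing = false
  ... | just ℓ₀ = any (λ x → ⌊ x ≟ᶠ u ⌋) (visits (n + L + 1) s ℓ₀)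

countPasses : (n L : ℕ) → (s u t : Fin n) → ℕ
countPasses n L s u t =
  length (filter (λ m → T? (Search.passesThrough m s t u)) (allAssignments n L))

{-# OPTIONS --safe #-}
-- If the search from s to t visits u, it stands on u at some level ℓ, and at that moment no
-- node of (u, t] lies in the level-(ℓ+1) list of s. Taking k ≥ ℓ maximal with u in the
-- level-k list of s, u agrees with s on exactly k bits while every node of (u, t] disagrees
-- with s within its first k + 1 bits. Given m(s) these are independent conditions on single
-- nodes, so this event has probability 2^-(k+1) (1 - 2^-(k+1))^d. Summed over k, Bernoulli's
-- inequality telescopes the total to at most (2 - 2^-d)/(d+1) < 2/(d+1). Probabilities are
-- counted as numbers of truncated assignments out of 2^(nL).
module Submission where

open import Defs

module PassingProbability where

  open import Data.Bool using (Bool; true; false; _∧_; not; if_then_else_; T)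
  open import Data.Bool.Properties using (T-∧; T-≡; T-not-≡; ∧-zeroʳ) renaming (_≟_ to _≟ᵇ_)
  open import Data.Empty using (⊥-elim)
  open import Data.Fin using (Fin; toℕ)
  open import Data.Fin.Properties using (toℕ-injective; toℕ<n) renaming (_≟_ to _≟ᶠ_)
  import Data.Integer as ℤ
  import Data.Integer.Properties as ℤ
  open import Data.List using (List; []; _∷_; _++_; map; concatMap; length; filter; findᵇ; allFin; upTo; applyUpTo; downFrom)
  open import Data.List.Membership.Propositional using (_∈_)
  open import Data.List.Membership.Propositional.Properties using (∈-map⁺; ∈-concat⁺′; ∈-allFin; ∈-downFrom⁺; ∈-downFrom⁻)
  open import Data.List.Properties using (map-++; map-cong; map-∘)
  import Data.List.Relation.Unary.All as All
  open import Data.List.Relation.Unary.AllPairs using (AllPairs; _∷_)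
  open import Data.List.Relation.Unary.AllPairs.Properties using (tabulate⁺-<)
  open import Data.List.Relation.Unary.Any as Any using (here; there)
  open import Data.List.Relation.Unary.Any.Properties using (any⁺; any⁻)
  open import Data.Maybe using (Maybe; just; nothing)
  open import Data.Nat using (ℕ; zero; suc; _+_; _*_; _∸_; _^_; _≤_; _<_; _≤ᵇ_; _<ᵇ_; _≡ᵇ_; z≤n; s≤s; z<s; NonZero)
  open import Data.Nat.ListAction using (sum)
  open import Data.Nat.ListAction.Properties using (sum-++)
  open import Data.Nat.Properties
  open import Algebra.Properties.CommutativeSemigroup *-commutativeSemigroup using (x∙yz≈y∙xz)
  open import Data.Nat.Tactic.RingSolver using (solve-∀)
  open import Data.Product using (∃-syntax; _×_; _,_; proj₁; proj₂)
  open import Data.Rational using (_/_; toℚᵘ) renaming (_<_ to _<ℚ_; _≤_ to _≤ℚ_; _*_ to _*ℚ_)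
  open import Data.Rational.Properties using (toℚᵘ-cancel-<; toℚᵘ-cancel-≤; toℚᵘ-fromℚᵘ; toℚᵘ-homo-*)
  open import Data.Rational.Unnormalised as ℚᵘ using (mkℚᵘ; *≤*; *<*)
  import Data.Rational.Unnormalised.Properties as ℚᵘ
  open import Data.Sum using (_⊎_; inj₁; inj₂; [_,_]′)
  open import Data.Unit using (tt)
  open import Data.Vec using (Vec; []; _∷_; lookup; replicate)
  open import Function using (_∘_; id; Equivalence)
  open import Relation.Binary.PropositionalEquality using (_≡_; _≢_; refl; sym; trans; cong; cong₂; subst; subst₂; module ≡-Reasoning)
  open import Relation.Nullary using (¬_; yes; no; ofʸ; ofⁿ)
  open import Relation.Nullary.Decidable using (T?; ⌊_⌋; toWitness; fromWitnessFalse)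

  private
    variable
      A B : Set

  -- Counting over lists and vectors

  𝟙 : Bool → ℕ
  𝟙 true  = 1
  𝟙 false = 0

  ∑ : List A → (A → ℕ) → ℕ
  ∑ xs f = sum (map f xs)

  infix 5 ∑
  syntax ∑ xs (λ x → e) = ∑[ x ∈ xs ] e

  ∑-cong : ∀ (xs : List A) {f g : A → ℕ} → (∀ x → f x ≡ g x) → ∑ xs f ≡ ∑ xs g
  ∑-cong xs f≗g = cong sum (map-cong f≗g xs)

  ∑-mono : ∀ (xs : List A) {f g : A → ℕ} → (∀ x → x ∈ xs → f x ≤ g x) → ∑ xs f ≤ ∑ xs g
  ∑-mono []       f≤g = z≤n
  ∑-mono (x ∷ xs) f≤g = +-mono-≤ (f≤g x (here refl)) (∑-mono xs (λ y y∈xs → f≤g y (there y∈xs)))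

  ∑-+ : ∀ (xs : List A) (f g : A → ℕ) → ∑[ x ∈ xs ] (f x + g x) ≡ ∑ xs f + ∑ xs g
  ∑-+ []       f g = refl
  ∑-+ (x ∷ xs) f g rewrite ∑-+ xs f g = interchange (f x) (g x) (∑ xs f) (∑ xs g)
    where
    interchange : ∀ a b c d → a + b + (c + d) ≡ a + c + (b + d)
    interchange = solve-∀

  ∑-*ˡ : ∀ (xs : List A) c (f : A → ℕ) → ∑[ x ∈ xs ] (c * f x) ≡ c * ∑ xs f
  ∑-*ˡ []       c f = sym (*-zeroʳ c)
  ∑-*ˡ (x ∷ xs) c f rewrite ∑-*ˡ xs c f = sym (*-distribˡ-+ c (f x) (∑ xs f))

  ∑-*ʳ : ∀ (xs : List A) c (f : A → ℕ) → ∑[ x ∈ xs ] (f x * c) ≡ ∑ xs f * c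
  ∑-*ʳ xs c f = trans (∑-cong xs (λ x → *-comm (f x) c)) (trans (∑-*ˡ xs c f) (*-comm c (∑ xs f)))

  ∑-const : ∀ (xs : List A) c → ∑[ x ∈ xs ] c ≡ length xs * c
  ∑-const []       c = refl
  ∑-const (x ∷ xs) c = cong (c +_) (∑-const xs c)

  ∑-comm : ∀ (xs : List A) (ys : List B) (f : A → B → ℕ) →
    ∑[ x ∈ xs ] ∑[ y ∈ ys ] f x y ≡ ∑[ y ∈ ys ] ∑[ x ∈ xs ] f x y
  ∑-comm []       ys f = sym (trans (∑-const ys 0) (*-zeroʳ (length ys)))
  ∑-comm (x ∷ xs) ys f rewrite ∑-comm xs ys f = sym (∑-+ ys (f x) (λ y → ∑[ x ∈ xs ] f x y))

  ∑-map : ∀ (g : A → B) xs (f : B → ℕ) → ∑ (map g xs) f ≡ ∑ xs (f ∘ g)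
  ∑-map g xs f = cong sum (sym (map-∘ xs))

  ∑-concatMap : ∀ (g : A → List B) ys (f : B → ℕ) → ∑ (concatMap g ys) f ≡ ∑[ y ∈ ys ] ∑ (g y) f
  ∑-concatMap g []       f = refl
  ∑-concatMap g (y ∷ ys) f = begin
    sum (map f (g y ++ concatMap g ys))          ≡⟨ cong sum (map-++ f (g y) (concatMap g ys)) ⟩
    sum (map f (g y) ++ map f (concatMap g ys))  ≡⟨ sum-++ (map f (g y)) _ ⟩
    ∑ (g y) f + ∑ (concatMap g ys) f             ≡⟨ cong (∑ (g y) f +_) (∑-concatMap g ys f) ⟩
    ∑ (g y) f + (∑[ y ∈ ys ] ∑ (g y) f)          ∎
    where open ≡-Reasoning

  ∑-≥-term : ∀ {xs : List A} (f : A → ℕ) {x} → x ∈ xs → f x ≤ ∑ xs f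
  ∑-≥-term f (here refl)      = m≤m+n _ _
  ∑-≥-term f (there {y} x∈xs) = ≤-trans (∑-≥-term f x∈xs) (m≤n+m _ (f y))

  count : (A → Bool) → List A → ℕ
  count p xs = ∑[ x ∈ xs ] 𝟙 (p x)

  length-filter-T? : ∀ (p : A → Bool) xs → length (filter (T? ∘ p) xs) ≡ count p xs
  length-filter-T? p []       = refl
  length-filter-T? p (x ∷ xs) with p x
  ... | true  = cong suc (length-filter-T? p xs)
  ... | false = length-filter-T? p xs

  count-false : ∀ (xs : List A) → count (λ _ → false) xs ≡ 0
  count-false xs = trans (∑-const xs 0) (*-zeroʳ (length xs))

  count-true : ∀ (xs : List A) → count (λ _ → true) xs ≡ length xs
  count-true xs = trans (∑-const xs 1) (*-identityʳ (length xs))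

  count-split : ∀ (p q : A → Bool) xs →
    count p xs ≡ count (λ x → p x ∧ q x) xs + count (λ x → p x ∧ not (q x)) xs
  count-split p q xs = trans (∑-cong xs (λ x → split (p x) (q x))) (∑-+ xs _ _)
    where
    split : ∀ a b → 𝟙 a ≡ 𝟙 (a ∧ b) + 𝟙 (a ∧ not b)
    split false b     = refl
    split true  false = refl
    split true  true  = refl

  count-union-bound : ∀ (p : A → Bool) (is : List B) (q : B → A → Bool) xs →
    (∀ x → T (p x) → ∃[ i ] i ∈ is × T (q i x)) → count p xs ≤ ∑[ i ∈ is ] count (q i) xs
  count-union-bound p is q xs covered = begin
    ∑[ x ∈ xs ] 𝟙 (p x)                  ≤⟨ ∑-mono xs (λ x _ → 𝟙-≤ (covered x)) ⟩
    ∑[ x ∈ xs ] ∑[ i ∈ is ] 𝟙 (q i x)    ≡⟨ ∑-comm xs is (λ x i → 𝟙 (q i x)) ⟩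
    ∑[ i ∈ is ] count (q i) xs            ∎
    where
    open ≤-Reasoning
    𝟙-≤ : ∀ {b x} → (T b → ∃[ i ] i ∈ is × T (q i x)) → 𝟙 b ≤ ∑[ i ∈ is ] 𝟙 (q i x)
    𝟙-≤ {false} _ = z≤n
    𝟙-≤ {true} {x} h with h tt
    ... | i , i∈is , qix =
      ≤-trans (≤-reflexive (sym (cong 𝟙 (Equivalence.to T-≡ qix)))) (∑-≥-term (λ i → 𝟙 (q i x)) i∈is)

  ∏< : ℕ → (ℕ → ℕ) → ℕ
  ∏< zero    g = 1
  ∏< (suc k) g = g 0 * ∏< k (g ∘ suc)

  infix 5 ∏<
  syntax ∏< k (λ i → e) = ∏[ i < k ] e

  ∏-cong : ∀ k {f g : ℕ → ℕ} → (∀ i → f i ≡ g i) → ∏< k f ≡ ∏< k g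
  ∏-cong zero    f≗g = refl
  ∏-cong (suc k) f≗g = cong₂ _*_ (f≗g 0) (∏-cong k (f≗g ∘ suc))

  ∏-const : ∀ k c → ∏< k (λ _ → c) ≡ c ^ k
  ∏-const zero    c = refl
  ∏-const (suc k) c = cong (c *_) (∏-const k c)

  allAt : ∀ {k} → (ℕ → A → Bool) → Vec A k → Bool
  allAt q []      = true
  allAt q (x ∷ v) = q 0 x ∧ allAt (q ∘ suc) v

  allAt-intro : ∀ {k} (q : ℕ → A → Bool) (v : Vec A k) → (∀ i → T (q (toℕ i) (lookup v i))) → T (allAt q v)
  allAt-intro q []      h = tt
  allAt-intro q (x ∷ v) h = Equivalence.from T-∧ (h Fin.zero , allAt-intro (q ∘ suc) v (h ∘ Fin.suc))

  count-allVecs : ∀ (xs : List A) k (q : ℕ → A → Bool) →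
    count (allAt q) (allVecs xs k) ≡ ∏[ i < k ] count (q i) xs
  count-allVecs xs zero    q = refl
  count-allVecs xs (suc k) q = begin
    count (allAt q) (concatMap (λ v → map (_∷ v) xs) vs)
      ≡⟨ ∑-concatMap _ vs _ ⟩
    ∑[ v ∈ vs ] count (allAt q) (map (_∷ v) xs)
      ≡⟨ ∑-cong vs (λ v → trans (∑-map (_∷ v) xs _) (∑-cong xs (λ x → 𝟙-∧ (q 0 x) _))) ⟩
    ∑[ v ∈ vs ] ∑[ x ∈ xs ] (𝟙 (q 0 x) * 𝟙 (allAt (q ∘ suc) v))
      ≡⟨ ∑-cong vs (λ v → ∑-*ʳ xs (𝟙 (allAt (q ∘ suc) v)) (𝟙 ∘ q 0)) ⟩
    ∑[ v ∈ vs ] (count (q 0) xs * 𝟙 (allAt (q ∘ suc) v))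
      ≡⟨ ∑-*ˡ vs (count (q 0) xs) (𝟙 ∘ allAt (q ∘ suc)) ⟩
    count (q 0) xs * count (allAt (q ∘ suc)) vs
      ≡⟨ cong (count (q 0) xs *_) (count-allVecs xs k (q ∘ suc)) ⟩
    ∏[ i < suc k ] count (q i) xs ∎
    where
    open ≡-Reasoning
    vs = allVecs xs k
    𝟙-∧ : ∀ a b → 𝟙 (a ∧ b) ≡ 𝟙 a * 𝟙 b
    𝟙-∧ false b = refl
    𝟙-∧ true  b = sym (+-identityʳ (𝟙 b))

  -- Membership vectors

  agree-refl : ∀ {L} ℓ (x : Vec Bool L) → T (agree ℓ x x)
  agree-refl zero    x       = tt
  agree-refl (suc ℓ) []      = tt
  agree-refl (suc ℓ) (b ∷ x) with b ≟ᵇ b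
  ... | yes _  = agree-refl ℓ x
  ... | no b≢b = b≢b refl

  agree-mono : ∀ {L ℓ k} (x y : Vec Bool L) → ℓ ≤ k → T (agree k x y) → T (agree ℓ x y)
  agree-mono {ℓ = zero}          _       _       _         _ = tt
  agree-mono {ℓ = suc ℓ} {suc k} []      []      _         _ = tt
  agree-mono {ℓ = suc ℓ} {suc k} (b ∷ x) (c ∷ y) (s≤s ℓ≤k) h with b ≟ᵇ c
  ... | yes _ = agree-mono x y ℓ≤k h

  agree-lt : ∀ {L} k {x y : Vec Bool L} → T (agree k x y) → ¬ T (agree (suc k) x y) → k < L
  agree-lt k       {[]}    {[]}    _ ¬agree = ⊥-elim (¬agree tt)
  agree-lt zero    {_ ∷ _} {_ ∷ _} _ _      = s≤s z≤n
  agree-lt (suc k) {b ∷ x} {c ∷ y} h ¬agree with b ≟ᵇ c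
  ... | yes _ = s≤s (agree-lt k h ¬agree)

  ∈-allBits : ∀ {L} (x : Vec Bool L) → x ∈ allBits L
  ∈-allBits []      = here refl
  ∈-allBits (b ∷ x) = ∈-concat⁺′ (b∷x∈ b) (∈-map⁺ _ (∈-allBits x))
    where
    b∷x∈ : ∀ b → b ∷ x ∈ (false ∷ x) ∷ (true ∷ x) ∷ []
    b∷x∈ false = here refl
    b∷x∈ true  = there (here refl)

  count-allBits-suc : ∀ L (p : Vec Bool (suc L) → Bool) →
    count p (allBits (suc L)) ≡ count (p ∘ (false ∷_)) (allBits L) + count (p ∘ (true ∷_)) (allBits L)
  count-allBits-suc L p = begin
    count p (allBits (suc L))
      ≡⟨ ∑-concatMap _ (allBits L) _ ⟩
    ∑[ x ∈ allBits L ] (𝟙 (p (false ∷ x)) + (𝟙 (p (true ∷ x)) + 0))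
      ≡⟨ ∑-cong (allBits L) (λ x → cong (𝟙 (p (false ∷ x)) +_) (+-identityʳ _)) ⟩
    ∑[ x ∈ allBits L ] (𝟙 (p (false ∷ x)) + 𝟙 (p (true ∷ x)))
      ≡⟨ ∑-+ (allBits L) _ _ ⟩
    count (p ∘ (false ∷_)) (allBits L) + count (p ∘ (true ∷_)) (allBits L) ∎
    where open ≡-Reasoning

  count-agree : ∀ L ℓ (a : Vec Bool L) → count (λ x → agree ℓ x a) (allBits L) ≡ 2 ^ (L ∸ ℓ)
  count-agree zero    zero    []          = refl
  count-agree zero    (suc ℓ) []          = refl
  count-agree (suc L) zero    (_ ∷ a)     = begin
    count (λ _ → true) (allBits (suc L))
      ≡⟨ count-allBits-suc L _ ⟩
    count (λ _ → true) (allBits L) + count (λ _ → true) (allBits L)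
      ≡⟨ cong₂ _+_ (count-agree L 0 a) (count-agree L 0 a) ⟩
    2 ^ L + 2 ^ L
      ≡⟨ cong (2 ^ L +_) (sym (+-identityʳ (2 ^ L))) ⟩
    2 ^ suc L ∎
    where open ≡-Reasoning
  count-agree (suc L) (suc ℓ) (false ∷ a) = begin
    count (λ x → agree (suc ℓ) x (false ∷ a)) (allBits (suc L))
      ≡⟨ count-allBits-suc L _ ⟩
    count (λ x → agree ℓ x a) (allBits L) + count (λ _ → false) (allBits L)
      ≡⟨ cong₂ _+_ (count-agree L ℓ a) (count-false (allBits L)) ⟩
    2 ^ (L ∸ ℓ) + 0
      ≡⟨ +-identityʳ _ ⟩
    2 ^ (L ∸ ℓ) ∎
    where open ≡-Reasoning
  count-agree (suc L) (suc ℓ) (true ∷ a)  = begin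
    count (λ x → agree (suc ℓ) x (true ∷ a)) (allBits (suc L))
      ≡⟨ count-allBits-suc L _ ⟩
    count (λ _ → false) (allBits L) + count (λ x → agree ℓ x a) (allBits L)
      ≡⟨ cong₂ _+_ (count-false (allBits L)) (count-agree L ℓ a) ⟩
    2 ^ (L ∸ ℓ) ∎
    where open ≡-Reasoning

  length-allBits : ∀ L → length (allBits L) ≡ 2 ^ L
  length-allBits L = trans (sym (count-true (allBits L))) (count-agree L 0 (replicate L false))

  module _ {L k : ℕ} (a : Vec Bool L) where

    count-disagree : count (λ x → not (agree (suc k) x a)) (allBits L) ≡ 2 ^ L ∸ 2 ^ (L ∸ suc k)
    count-disagree = begin
      W          ≡⟨ sym (m+n∸m≡n X W) ⟩
      X + W ∸ X  ≡⟨ cong (_∸ X) X+W≡2^L ⟩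
      2 ^ L ∸ X  ∎
      where
      open ≡-Reasoning
      X = 2 ^ (L ∸ suc k)
      W = count (λ x → not (agree (suc k) x a)) (allBits L)
      X+W≡2^L : X + W ≡ 2 ^ L
      X+W≡2^L = begin
        X + W
          ≡⟨ cong (_+ W) (sym (count-agree L (suc k) a)) ⟩
        count (λ x → agree (suc k) x a) (allBits L) + W
          ≡⟨ sym (count-split (λ _ → true) (λ x → agree (suc k) x a) (allBits L)) ⟩
        count (λ _ → true) (allBits L)
          ≡⟨ count-agree L 0 a ⟩
        2 ^ L ∎

    count-agree-exactly : k < L → count (λ x → agree k x a ∧ not (agree (suc k) x a)) (allBits L) ≡ 2 ^ (L ∸ suc k)
    count-agree-exactly k<L = +-cancelˡ-≡ X E X (begin
      X + E
        ≡⟨ cong (_+ E) (sym (count-agree L (suc k) a)) ⟩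
      count (λ x → agree (suc k) x a) (allBits L) + E
        ≡⟨ cong (_+ E) (∑-cong (allBits L) (cong 𝟙 ∘ implied)) ⟩
      count (λ x → agree k x a ∧ agree (suc k) x a) (allBits L) + E
        ≡⟨ sym (count-split _ (λ x → agree (suc k) x a) (allBits L)) ⟩
      count (λ x → agree k x a) (allBits L)
        ≡⟨ count-agree L k a ⟩
      2 ^ (L ∸ k)
        ≡⟨ cong (2 ^_) (+-∸-assoc 1 k<L) ⟩
      2 * X
        ≡⟨ cong (X +_) (+-identityʳ X) ⟩
      X + X ∎)
      where
      open ≡-Reasoning
      X = 2 ^ (L ∸ suc k)
      E = count (λ x → agree k x a ∧ not (agree (suc k) x a)) (allBits L)
      absorb : ∀ {b c} → (T c → T b) → c ≡ b ∧ c
      absorb {b}     {false} _ = sym (∧-zeroʳ b)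
      absorb {true}  {true}  _ = refl
      absorb {false} {true}  h = ⊥-elim (h tt)
      implied : ∀ x → agree (suc k) x a ≡ agree k x a ∧ agree (suc k) x a
      implied x = absorb (agree-mono x a (n≤1+n k))

  -- Profiles over node positions

  _[_↦_] : (ℕ → B) → ℕ → B → ℕ → B
  (g [ j ↦ c ]) i = if i ≡ᵇ j then c else g i

  [↦]-intro : ∀ (P : B → Set) (g : ℕ → B) {j c} i → (i ≡ j → P c) → P (g i) → P ((g [ j ↦ c ]) i)
  [↦]-intro P g {j} i Pc Pg with i ≡ᵇ j in eq
  ... | true  = Pc (≡ᵇ⇒≡ i j (subst T (sym eq) tt))
  ... | false = Pg

  [↦]-other : ∀ (g : ℕ → B) {j c i} → i ≢ j → (g [ j ↦ c ]) i ≡ g i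
  [↦]-other g {j} {i = i} i≢j with i ≡ᵇ j in eq
  ... | true  = ⊥-elim (i≢j (≡ᵇ⇒≡ i j (subst T (sym eq) tt)))
  ... | false = refl

  [↦]-map : ∀ {C : Set} (f : B → C) {g : ℕ → B} {g′ : ℕ → C} {j c c′} →
    (∀ i → f (g i) ≡ g′ i) → f c ≡ c′ → ∀ i → f ((g [ j ↦ c ]) i) ≡ (g′ [ j ↦ c′ ]) i
  [↦]-map f {j = j} fg≗g′ fc≡c′ i with i ≡ᵇ j
  ... | true  = fc≡c′
  ... | false = fg≗g′ i

  ∏-update : ∀ k (g : ℕ → ℕ) j c → j < k → ∏< k (g [ j ↦ c ]) * g j ≡ c * ∏< k g
  ∏-update (suc k) g zero    c _ = trans (*-assoc c _ (g 0)) (cong (c *_) (*-comm _ (g 0)))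
  ∏-update (suc k) g (suc j) c (s≤s j<k) = begin
    g 0 * ∏< k ((g ∘ suc) [ j ↦ c ]) * g (suc j)    ≡⟨ *-assoc (g 0) _ _ ⟩
    g 0 * (∏< k ((g ∘ suc) [ j ↦ c ]) * g (suc j))  ≡⟨ cong (g 0 *_) (∏-update k (g ∘ suc) j c j<k) ⟩
    g 0 * (c * ∏< k (g ∘ suc))                       ≡⟨ x∙yz≈y∙xz (g 0) c _ ⟩
    c * (g 0 * ∏< k (g ∘ suc))                       ∎
    where open ≡-Reasoning

  box : ℕ → ℕ → B → B → ℕ → B
  box u zero    w o = λ _ → o
  box u (suc e) w o = box u e w o [ u + suc e ↦ w ]

  box-intro : ∀ (P : B → Set) u e {w o} i → (u < i → i ≤ u + e → P w) → P o → P (box u e w o i)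
  box-intro P u zero    i Pw Po = Po
  box-intro P u (suc e) i Pw Po = [↦]-intro P (box u e _ _) i
    (λ { refl → Pw (m<m+n u z<s) ≤-refl })
    (box-intro P u e i (λ u<i i≤u+e → Pw u<i (≤-trans i≤u+e (+-monoʳ-≤ u (n≤1+n e)))) Po)

  box-outside : ∀ u e {w o : B} {i} → ¬ (u < i × i ≤ u + e) → box u e w o i ≡ o
  box-outside u zero    _ = refl
  box-outside u (suc e) ∉ = trans
    ([↦]-other (box u e _ _) (λ { refl → ∉ (m<m+n u z<s , ≤-refl) }))
    (box-outside u e (λ (u<i , i≤u+e) → ∉ (u<i , ≤-trans i≤u+e (+-monoʳ-≤ u (n≤1+n e)))))

  box-map : ∀ {C : Set} (f : B → C) u e {w o w′ o′} → f w ≡ w′ → f o ≡ o′ →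
    ∀ i → f (box u e w o i) ≡ box u e w′ o′ i
  box-map f u zero    fw fo i = fo
  box-map f u (suc e) fw fo i = [↦]-map f (box-map f u e fw fo) fw i

  ∏-box : ∀ n u e (w o : ℕ) → u + e < n → ∏< n (box u e w o) * o ^ e ≡ w ^ e * o ^ n
  ∏-box n u zero    w o _       = trans (*-identityʳ _) (trans (∏-const n o) (sym (*-identityˡ _)))
  ∏-box n u (suc e) w o j<n = begin
    ∏< n (b [ j ↦ w ]) * (o * o ^ e)  ≡⟨ sym (*-assoc (∏< n (b [ j ↦ w ])) o _) ⟩
    ∏< n (b [ j ↦ w ]) * o * o ^ e    ≡⟨ cong (λ x → ∏< n (b [ j ↦ w ]) * x * o ^ e) (sym bj≡o) ⟩
    ∏< n (b [ j ↦ w ]) * b j * o ^ e  ≡⟨ cong (_* o ^ e) (∏-update n b j w j<n) ⟩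
    w * ∏< n b * o ^ e                ≡⟨ *-assoc w _ _ ⟩
    w * (∏< n b * o ^ e)              ≡⟨ cong (w *_) (∏-box n u e w o (<-trans u+e<j j<n)) ⟩
    w * (w ^ e * o ^ n)               ≡⟨ sym (*-assoc w _ _) ⟩
    w ^ suc e * o ^ n                 ∎
    where
    open ≡-Reasoning
    b = box u e w o
    j = u + suc e
    u+e<j : u + e < j
    u+e<j = +-monoʳ-< u (n<1+n e)
    bj≡o : b j ≡ o
    bj≡o = box-outside u e (λ (_ , j≤u+e) → <⇒≱ u+e<j j≤u+e)

  profile : ℕ → ℕ → ℕ → B → B → B → B → ℕ → B
  profile s u e cs cu cw co = (box u e cw co [ u ↦ cu ]) [ s ↦ cs ]

  profile-intro : ∀ (P : B → Set) s u e cs cu cw co i →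
    (i ≡ s → P cs) → (i ≡ u → P cu) → (u < i → i ≤ u + e → P cw) → P co → P (profile s u e cs cu cw co i)
  profile-intro P s u e cs cu cw co i Ps Pu Pw Po =
    [↦]-intro P (box u e cw co [ u ↦ cu ]) i Ps ([↦]-intro P (box u e cw co) i Pu (box-intro P u e i Pw Po))

  profile-map : ∀ {C : Set} (f : B → C) s u e {cs cu cw co cs′ cu′ cw′ co′} →
    f cs ≡ cs′ → f cu ≡ cu′ → f cw ≡ cw′ → f co ≡ co′ →
    ∀ i → f (profile s u e cs cu cw co i) ≡ profile s u e cs′ cu′ cw′ co′ i
  profile-map f s u e fs fu fw fo = [↦]-map f ([↦]-map f (box-map f u e fw fo) fu) fs

  ∏-profile : ∀ n s u e (cs cu cw co : ℕ) → s < u → u + e < n →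
    ∏< n (profile s u e cs cu cw co) * co ^ (2 + e) ≡ cs * cu * cw ^ e * co ^ n
  ∏-profile n s u e cs cu cw co s<u u+e<n = begin
    ∏< n (g [ s ↦ cs ]) * (co * (co * co ^ e))  ≡⟨ sym (*-assoc (∏< n (g [ s ↦ cs ])) co _) ⟩
    ∏< n (g [ s ↦ cs ]) * co * (co * co ^ e)    ≡⟨ cong (λ x → ∏< n (g [ s ↦ cs ]) * x * (co * co ^ e)) (sym gs≡co) ⟩
    ∏< n (g [ s ↦ cs ]) * g s * (co * co ^ e)   ≡⟨ cong (_* (co * co ^ e)) (∏-update n g s cs (<-trans s<u u<n)) ⟩
    cs * ∏< n g * (co * co ^ e)                 ≡⟨ reassoc cs (∏< n g) co (co ^ e) ⟩
    cs * (∏< n g * co * co ^ e)                 ≡⟨ cong (λ x → cs * (∏< n g * x * co ^ e)) (sym bu≡co) ⟩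
    cs * (∏< n g * b u * co ^ e)                ≡⟨ cong (λ x → cs * (x * co ^ e)) (∏-update n b u cu u<n) ⟩
    cs * (cu * ∏< n b * co ^ e)                 ≡⟨ cong (cs *_) (*-assoc cu _ _) ⟩
    cs * (cu * (∏< n b * co ^ e))               ≡⟨ cong (λ x → cs * (cu * x)) (∏-box n u e cw co u+e<n) ⟩
    cs * (cu * (cw ^ e * co ^ n))               ≡⟨ reassoc′ cs cu (cw ^ e) (co ^ n) ⟩
    cs * cu * cw ^ e * co ^ n                   ∎
    where
    open ≡-Reasoning
    b = box u e cw co
    g = b [ u ↦ cu ]
    u<n = ≤-<-trans (m≤m+n u e) u+e<n
    bu≡co : b u ≡ co
    bu≡co = box-outside u e (λ (u<u , _) → <-irrefl refl u<u)
    gs≡co : g s ≡ co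
    gs≡co = trans ([↦]-other b (<⇒≢ s<u)) (box-outside u e (λ (u<s , _) → <-asym s<u u<s))
    reassoc : ∀ a b c d → a * b * (c * d) ≡ a * (b * c * d)
    reassoc = solve-∀
    reassoc′ : ∀ a b c d → a * (b * (c * d)) ≡ a * b * c * d
    reassoc′ = solve-∀

  -- The search

  findᵇ-unique : ∀ (p : A → Bool) (f : List A → Maybe A) → f [] ≡ nothing →
    (∀ x xs → f (x ∷ xs) ≡ (if p x then just x else f xs)) → ∀ xs → f xs ≡ findᵇ p xs
  findᵇ-unique p f f[] f∷ []       = f[]
  findᵇ-unique p f f[] f∷ (x ∷ xs) rewrite f∷ x xs | findᵇ-unique p f f[] f∷ xs = refl

  findᵇ-just : ∀ (p : A → Bool) xs {w} → findᵇ p xs ≡ just w → T (p w)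
  findᵇ-just p (x ∷ xs) eq with p x in px
  findᵇ-just p (x ∷ xs) refl | true  = subst T (sym px) tt
  findᵇ-just p (x ∷ xs) eq   | false = findᵇ-just p xs eq

  findᵇ-nothing : ∀ (p : A → Bool) {xs x} → findᵇ p xs ≡ nothing → x ∈ xs → ¬ T (p x)
  findᵇ-nothing p {y ∷ xs} eq x∈ with p y in py
  findᵇ-nothing p {y ∷ xs} () x∈          | true
  findᵇ-nothing p {y ∷ xs} eq (here refl) | false = subst T py
  findᵇ-nothing p {y ∷ xs} eq (there x∈)  | false = findᵇ-nothing p eq x∈

  findᵇ-least : ∀ {R : A → A → Set} (p : A → Bool) {xs w x} → AllPairs R xs →
    findᵇ p xs ≡ just w → x ∈ xs → T (p x) → x ≡ w ⊎ R w x
  findᵇ-least p {y ∷ xs} (y<xs ∷ sorted) eq x∈ px with p y in py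
  findᵇ-least p {y ∷ xs} (y<xs ∷ sorted) refl (here refl) px | true  = inj₁ refl
  findᵇ-least p {y ∷ xs} (y<xs ∷ sorted) refl (there x∈) px  | true  = inj₂ (All.lookup y<xs x∈)
  findᵇ-least p {y ∷ xs} (y<xs ∷ sorted) eq (here refl) px   | false = ⊥-elim (subst T py px)
  findᵇ-least p {y ∷ xs} (y<xs ∷ sorted) eq (there x∈) px    | false = findᵇ-least p sorted eq x∈ px

  boundary : ∀ (g : ℕ → Bool) {a b} → a ≤ b → T (g a) → ¬ T (g b) → ∃[ k ] a ≤ k × T (g k) × ¬ T (g (suc k))
  boundary g {b = zero}    z≤n ga ¬g0 = ⊥-elim (¬g0 ga)
  boundary g {a} {suc b} a≤1+b ga ¬g1+b with m≤n⇒m<n∨m≡n a≤1+b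
  ... | inj₂ refl = ⊥-elim (¬g1+b ga)
  ... | inj₁ (s≤s a≤b) with T? (g b)
  ...   | yes gb = b , a≤b , gb , ¬g1+b
  ...   | no ¬gb = boundary g a≤b ga ¬gb

  module SearchFacts {n L : ℕ} (m : Assignment n L) (s t : Fin n) where
    open Search m s t

    laterIn : ℕ → Fin n → Fin n → Bool
    laterIn ℓ v w = (toℕ v <ᵇ toℕ w) ∧ inList ℓ w

    laterIn-intro : ∀ ℓ {v x} → toℕ v < toℕ x → T (inList ℓ x) → T (laterIn ℓ v x)
    laterIn-intro ℓ v<x x∈ℓ = Equivalence.from T-∧ (<⇒<ᵇ v<x , x∈ℓ)

    -- successor and startLevel run where-bound loops that cannot be named from here;
    -- the with-abstraction lets unification solve leastAbove and firstAlone as those loops.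
    mutual
      private
        leastAbove : ℕ → Fin n → List (Fin n) → Maybe (Fin n)
        leastAbove ℓ v = _

        firstAlone : List ℕ → Maybe ℕ
        firstAlone = _

      successor≡findᵇ : ∀ ℓ v → successor ℓ v ≡ findᵇ (laterIn ℓ v) (allFin n)
      successor≡findᵇ ℓ v with allFin n
      ... | ws = findᵇ-unique _ (leastAbove ℓ v) refl (λ _ _ → refl) ws

      startLevel≡findᵇ : startLevel ≡ findᵇ alone (upTo (suc L))
      startLevel≡findᵇ with applyUpTo suc L
      ... | ℓs = cong (if alone 0 then just 0 else_) (findᵇ-unique _ firstAlone refl (λ _ _ → refl) ℓs)

    data IsSuccessor (ℓ : ℕ) (v : Fin n) : Maybe (Fin n) → Set where
      none : (∀ x → toℕ v < toℕ x → ¬ T (inList ℓ x)) → IsSuccessor ℓ v nothing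
      next : ∀ {w} → toℕ v < toℕ w → T (inList ℓ w) →
             (∀ x → toℕ v < toℕ x → toℕ x < toℕ w → ¬ T (inList ℓ x)) → IsSuccessor ℓ v (just w)

    successor-correct : ∀ ℓ v → IsSuccessor ℓ v (successor ℓ v)
    successor-correct ℓ v rewrite successor≡findᵇ ℓ v with findᵇ (laterIn ℓ v) (allFin n) in eq
    ... | nothing = none (λ x v<x x∈ℓ → findᵇ-nothing (laterIn ℓ v) eq (∈-allFin x) (laterIn-intro ℓ v<x x∈ℓ))
    ... | just w with Equivalence.to T-∧ (findᵇ-just (laterIn ℓ v) (allFin n) eq)
    ...   | v<ᵇw , w∈ℓ = next (<ᵇ⇒< _ _ v<ᵇw) w∈ℓ λ x v<x x<w x∈ℓ →
      [ (λ { refl → <-irrefl refl x<w }) , <-asym x<w ]′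
        (findᵇ-least (laterIn ℓ v) (tabulate⁺-< id) eq (∈-allFin x) (laterIn-intro ℓ v<x x∈ℓ))

    inList-mono : ∀ x {ℓ k} → ℓ ≤ k → T (inList k x) → T (inList ℓ x)
    inList-mono x = agree-mono (mv x) (mv s)

    inList-below : ∀ x {ℓ k} → T (inList ℓ x) → ¬ T (inList k x) → ℓ < k
    inList-below x x∈ℓ x∉k = ≰⇒> (λ k≤ℓ → x∉k (inList-mono x k≤ℓ x∈ℓ))

    Reached : Fin n → ℕ → Set
    Reached v ℓ = T (inList ℓ v) × (∀ x → toℕ v < toℕ x → toℕ x ≤ toℕ t → ¬ T (inList (suc ℓ) x))

    mutual
      visits-reached : ∀ f {v ℓ x} → Reached v ℓ → x ∈ visits f v ℓ → ∃[ ℓ′ ] Reached x ℓ′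
      visits-reached zero    r (here refl) = _ , r
      visits-reached (suc f) r x∈          = step-reached f r (successor-correct _ _) x∈

      step-reached : ∀ f {v ℓ x w?} → Reached v ℓ → IsSuccessor ℓ v w? →
                     x ∈ step f v ℓ w? → ∃[ ℓ′ ] Reached x ℓ′
      step-reached f r (none empty) x∈ = down-reached f r (λ x v<x _ → empty x v<x) x∈
      step-reached f {v} r (next {w} v<w w∈ℓ between) x∈ with toℕ w ≤ᵇ toℕ t | ≤ᵇ-reflects-≤ (toℕ w) (toℕ t)
      ... | false | ofⁿ w≰t = down-reached f r (λ x v<x x≤t → between x v<x (≤-<-trans x≤t (≰⇒> w≰t))) x∈
      ... | true  | ofʸ _ with x∈
      ...   | here refl = _ , r
      ...   | there x∈′ = visits-reached f (w∈ℓ , λ x w<x x≤t → proj₂ r x (<-trans v<w w<x) x≤t) x∈′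

      down-reached : ∀ f {v ℓ x} → Reached v ℓ → (∀ x → toℕ v < toℕ x → toℕ x ≤ toℕ t → ¬ T (inList ℓ x)) →
                     x ∈ down f v ℓ → ∃[ ℓ′ ] Reached x ℓ′
      down-reached f {ℓ = zero}  r _   (here refl) = _ , r
      down-reached f {ℓ = suc ℓ} r _   (here refl) = _ , r
      down-reached f {ℓ = suc ℓ} r gap (there x∈)  = visits-reached f (inList-mono _ (n≤1+n ℓ) (proj₁ r) , gap) x∈

    PassesAt : ℕ → Fin n → Set
    PassesAt k u = T (inList k u) × ¬ T (inList (suc k) u) ×
                   (∀ x → toℕ u < toℕ x → toℕ x ≤ toℕ t → ¬ T (inList (suc k) x))

    reached⇒PassesAt : ∀ u ℓ₀ → ¬ T (inList ℓ₀ u) → ∃[ ℓ ] Reached u ℓ → ∃[ k ] k < L × PassesAt k u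
    reached⇒PassesAt u ℓ₀ u∉ℓ₀ (ℓ , u∈ℓ , gap)
      with boundary (λ k → inList k u) {b = ℓ₀} (<⇒≤ (inList-below u u∈ℓ u∉ℓ₀)) u∈ℓ u∉ℓ₀
    ... | k , ℓ≤k , u∈k , u∉k+1 =
      k , agree-lt k u∈k u∉k+1 , u∈k , u∉k+1 , λ x u<x x≤t → gap x u<x x≤t ∘ inList-mono x (s≤s ℓ≤k)

    alone-excludes : ∀ ℓ → T (alone ℓ) → ∀ x → x ≢ s → ¬ T (inList ℓ x)
    alone-excludes ℓ alone-ℓ x x≢s x∈ℓ =
      subst T (Equivalence.to T-not-≡ alone-ℓ) (any⁺ _ (Any.map (λ { refl → x-counts }) (∈-allFin x)))
      where
      x-counts : T (not ⌊ x ≟ᶠ s ⌋ ∧ inList ℓ x)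
      x-counts = Equivalence.from T-∧ (fromWitnessFalse x≢s , x∈ℓ)

    passes⇒PassesAt : ∀ u → toℕ s < toℕ u → T (passesThrough u) → ∃[ k ] k < L × PassesAt k u
    passes⇒PassesAt u s<u passes with startLevel in eq
    ... | nothing = ⊥-elim passes
    ... | just ℓ₀ = reached⇒PassesAt u ℓ₀ (excluded u s<u) (visits-reached (n + L + 1) start u-visited)
      where
      excluded : ∀ x → toℕ s < toℕ x → ¬ T (inList ℓ₀ x)
      excluded x s<x = alone-excludes ℓ₀ (findᵇ-just alone (upTo (suc L)) (trans (sym startLevel≡findᵇ) eq)) x
                         (λ { refl → <-irrefl refl s<x })
      start : Reached s ℓ₀
      start = agree-refl ℓ₀ (mv s) , λ x s<x _ → excluded x s<x ∘ inList-mono x (n≤1+n ℓ₀)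
      u-visited : u ∈ visits (n + L + 1) s ℓ₀
      u-visited = Any.map (λ x≡u → sym (toWitness x≡u)) (any⁻ _ _ passes)

  -- Arithmetic

  bernoulli : ∀ d a c → a ^ suc d + suc d * c * a ^ d ≤ (a + c) ^ suc d
  bernoulli zero    a c = ≤-reflexive (base a c)
    where
    base : ∀ a c → a * 1 + 1 * c * 1 ≡ (a + c) * 1
    base = solve-∀
  bernoulli (suc d) a c = begin
    a ^ (2 + d) + (2 + d) * c * a ^ suc d                          ≤⟨ m≤m+n _ (suc d * c * c * a ^ d) ⟩
    a ^ (2 + d) + (2 + d) * c * a ^ suc d + suc d * c * c * a ^ d  ≡⟨ expand d a c (a ^ d) ⟩
    (a + c) * (a ^ suc d + suc d * c * a ^ d)                      ≤⟨ *-monoʳ-≤ (a + c) (bernoulli d a c) ⟩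
    (a + c) ^ (2 + d)                                              ∎
    where
    open ≤-Reasoning
    expand : ∀ d a c p → a * (a * p) + (2 + d) * c * (a * p) + suc d * c * c * p ≡ (a + c) * (a * p + suc d * c * p)
    expand = solve-∀

  telescope : ∀ (F f : ℕ → ℕ) K → (∀ k → k < K → F k + f k ≤ F (suc k)) →
    F 0 + (∑[ k ∈ downFrom K ] f k) ≤ F K
  telescope F f zero    step = ≤-reflexive (+-identityʳ (F 0))
  telescope F f (suc K) step = begin
    F 0 + (f K + ∑ (downFrom K) f)  ≡⟨ cong (F 0 +_) (+-comm (f K) _) ⟩
    F 0 + (∑ (downFrom K) f + f K)  ≡⟨ sym (+-assoc (F 0) _ (f K)) ⟩
    F 0 + ∑ (downFrom K) f + f K    ≤⟨ +-monoˡ-≤ (f K) (telescope F f K (λ k k<K → step k (m<n⇒m<1+n k<K))) ⟩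
    F K + f K                       ≤⟨ step K ≤-refl ⟩
    F (suc K)                       ∎
    where open ≤-Reasoning

  ^-distribʳ-* : ∀ a b k → (a * b) ^ k ≡ a ^ k * b ^ k
  ^-distribʳ-* a b zero    = refl
  ^-distribʳ-* a b (suc k) = trans (cong (a * b *_) (^-distribʳ-* a b k)) ([m*n]*[o*p]≡[m*o]*[n*p] a b (a ^ k) (b ^ k))

  module LevelWeights (L : ℕ) where

    M : ℕ
    M = 2 ^ L

    X Y : ℕ → ℕ
    X k = 2 ^ (L ∸ suc k)
    Y k = M ∸ X k

    levelSum : ℕ → ℕ
    levelSum d = ∑[ k ∈ downFrom L ] X k * Y k ^ d

    -- F k = (2M - 2^(L-k))^(d+1) grows at each level by at least the level's term (Bernoulli).
    levelSum-bound : ∀ d → M ^ suc d + suc d * 2 ^ d * levelSum d ≤ 2 ^ suc d * M ^ suc d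
    levelSum-bound d = begin
      M ^ suc d + suc d * 2 ^ d * levelSum d  ≡⟨ cong₂ _+_ (cong (_^ suc d) (sym F0≡M)) (sym ∑f≡) ⟩
      F 0 + (∑[ k ∈ downFrom L ] f k)         ≤⟨ telescope F f L step ⟩
      F L                                     ≤⟨ ^-monoˡ-≤ (suc d) (m∸n≤m (2 * M) (2 ^ (L ∸ L))) ⟩
      (2 * M) ^ suc d                         ≡⟨ ^-distribʳ-* 2 M (suc d) ⟩
      2 ^ suc d * M ^ suc d                   ∎
      where
      open ≤-Reasoning
      F f : ℕ → ℕ
      F k = (2 * M ∸ 2 ^ (L ∸ k)) ^ suc d
      f k = suc d * X k * (2 * Y k) ^ d
      F0≡M : 2 * M ∸ 2 ^ L ≡ M
      F0≡M = trans (cong (_∸ M) (cong (M +_) (+-identityʳ M))) (m+n∸m≡n M M)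
      ∑f≡ : ∑[ k ∈ downFrom L ] f k ≡ suc d * 2 ^ d * levelSum d
      ∑f≡ = trans (∑-cong (downFrom L) (λ k → trans (cong (suc d * X k *_) (^-distribʳ-* 2 (Y k) d))
                                                     (regroup (suc d) (X k) (2 ^ d) (Y k ^ d))))
                  (∑-*ˡ (downFrom L) (suc d * 2 ^ d) _)
        where
        regroup : ∀ e x p y → e * x * (p * y) ≡ e * p * (x * y)
        regroup = solve-∀
      step : ∀ k → k < L → F k + f k ≤ F (suc k)
      step k k<L = begin
        F k + f k                                        ≡⟨ cong (λ z → z ^ suc d + f k) 2M∸2X≡2Y ⟩
        (2 * Y k) ^ suc d + suc d * X k * (2 * Y k) ^ d  ≤⟨ bernoulli d (2 * Y k) (X k) ⟩
        (2 * Y k + X k) ^ suc d                          ≡⟨ cong (_^ suc d) (sym 2M∸X≡2Y+X) ⟩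
        F (suc k)                                        ∎
        where
        Y+X≡M : Y k + X k ≡ M
        Y+X≡M = m∸n+n≡m (^-monoʳ-≤ 2 (m∸n≤m L (suc k)))
        2M≡2Y+2X : 2 * M ≡ 2 * Y k + 2 * X k
        2M≡2Y+2X = trans (cong (2 *_) (sym Y+X≡M)) (*-distribˡ-+ 2 (Y k) (X k))
        2M∸2X≡2Y : 2 * M ∸ 2 ^ (L ∸ k) ≡ 2 * Y k
        2M∸2X≡2Y = trans (cong₂ _∸_ 2M≡2Y+2X (cong (2 ^_) (+-∸-assoc 1 k<L))) (m+n∸n≡m (2 * Y k) (2 * X k))
        2M∸X≡2Y+X : 2 * M ∸ X k ≡ 2 * Y k + X k
        2M∸X≡2Y+X = trans (cong (_∸ X k) (trans 2M≡2Y+2X (regroup (Y k) (X k)))) (m+n∸n≡m (2 * Y k + X k) (X k))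
          where
          regroup : ∀ y x → 2 * y + 2 * x ≡ 2 * y + x + x
          regroup = solve-∀

  combine-bounds : ∀ c N S P B E .{{_ : NonZero P}} → c * P ≤ N * S → P + B * S ≤ E * P → c * B + N ≤ E * N
  combine-bounds c N S P B E cP≤NS P+BS≤EP = *-cancelʳ-≤ (c * B + N) (E * N) P (begin
    (c * B + N) * P    ≡⟨ expand c B N P ⟩
    c * P * B + N * P  ≤⟨ +-monoˡ-≤ (N * P) (*-monoˡ-≤ B cP≤NS) ⟩
    N * S * B + N * P  ≡⟨ collect N S B P ⟩
    N * (P + B * S)    ≤⟨ *-monoʳ-≤ N P+BS≤EP ⟩
    N * (E * P)        ≡⟨ x∙yz≈y∙xz N E P ⟩
    E * (N * P)        ≡⟨ sym (*-assoc E N P) ⟩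
    E * N * P          ∎)
    where
    open ≤-Reasoning
    expand : ∀ c b n p → (c * b + n) * p ≡ c * p * b + n * p
    expand = solve-∀
    collect : ∀ n s b p → n * s * b + n * p ≡ n * (p + b * s)
    collect = solve-∀

  toℚᵘ-+/ : ∀ a b → toℚᵘ (ℤ.+ a / suc b) ℚᵘ.≃ mkℚᵘ (ℤ.+ a) b
  toℚᵘ-+/ a b = toℚᵘ-fromℚᵘ (mkℚᵘ (ℤ.+ a) b)

  +/<+/ : ∀ a b c d .{{_ : NonZero b}} .{{_ : NonZero d}} → a * d < c * b → ℤ.+ a / b <ℚ ℤ.+ c / d
  +/<+/ a b@(suc b′) c d@(suc d′) ad<cb =
    toℚᵘ-cancel-< (ℚᵘ.<-respˡ-≃ (ℚᵘ.≃-sym (toℚᵘ-+/ a b′)) (ℚᵘ.<-respʳ-≃ (ℚᵘ.≃-sym (toℚᵘ-+/ c d′)) (*<* cross)))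
    where
    cross : ℤ.+ a ℤ.* ℤ.+ d ℤ.< ℤ.+ c ℤ.* ℤ.+ b
    cross = subst₂ ℤ._<_ (ℤ.pos-* a d) (ℤ.pos-* c b) (ℤ.+<+ ad<cb)

  +/1≤+/*+/1 : ∀ c a b p .{{_ : NonZero b}} → c * b ≤ a * p → ℤ.+ c / 1 ≤ℚ (ℤ.+ a / b) *ℚ (ℤ.+ p / 1)
  +/1≤+/*+/1 c a b@(suc b′) p cb≤ap =
    toℚᵘ-cancel-≤ (ℚᵘ.≤-respˡ-≃ (ℚᵘ.≃-sym (toℚᵘ-+/ c 0)) (ℚᵘ.≤-respʳ-≃ (ℚᵘ.≃-sym product) (*≤* cross)))
    where
    product : toℚᵘ ((ℤ.+ a / b) *ℚ (ℤ.+ p / 1)) ℚᵘ.≃ mkℚᵘ (ℤ.+ a) b′ ℚᵘ.* mkℚᵘ (ℤ.+ p) 0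
    product = ℚᵘ.≃-trans (toℚᵘ-homo-* (ℤ.+ a / b) (ℤ.+ p / 1)) (ℚᵘ.*-cong (toℚᵘ-+/ a b′) (toℚᵘ-+/ p 0))
    cross : ℤ.+ c ℤ.* ℤ.+ suc (b′ * 1) ℤ.≤ (ℤ.+ a ℤ.* ℤ.+ p) ℤ.* ℤ.+ 1
    cross = subst₂ ℤ._≤_ (ℤ.pos-* c (suc (b′ * 1))) (trans (ℤ.pos-* (a * p) 1) (cong (ℤ._* ℤ.+ 1) (ℤ.pos-* a p)))
      (ℤ.+≤+ (subst₂ _≤_ (cong (c *_) (sym (*-identityʳ b))) (sym (*-identityʳ (a * p))) cb≤ap))

  pred-2^[1+d]-bound : ∀ d → (2 ^ suc d ∸ 1) * suc d < 2 * (suc d * 2 ^ d)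
  pred-2^[1+d]-bound d = begin-strict
    (2 ^ suc d ∸ 1) * suc d  <⟨ *-monoˡ-< (suc d) (∸-monoʳ-< z<s (m^n>0 2 (suc d))) ⟩
    2 ^ suc d * suc d        ≡⟨ regroup (2 ^ d) d ⟩
    2 * (suc d * 2 ^ d)      ∎
    where
    open ≤-Reasoning
    regroup : ∀ p d → 2 * p * suc d ≡ 2 * (suc d * p)
    regroup = solve-∀

  -- Counting the assignments whose search passes through u

  ¬T⇒T-not : ∀ {b} → ¬ T b → T (not b)
  ¬T⇒T-not {false} _  = tt
  ¬T⇒T-not {true}  ¬t = ¬t tt

  module LevelEvents {n L : ℕ} (s u t : Fin n) (s<u : toℕ s < toℕ u) (u<t : toℕ u < toℕ t) where

    open LevelWeights L

    d : ℕ
    d = toℕ t ∸ toℕ u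

    u+d≡t : toℕ u + d ≡ toℕ t
    u+d≡t = m+[n∸m]≡n (<⇒≤ u<t)

    sameAs : Vec Bool L → Vec Bool L → Bool
    sameAs a x = agree L x a

    leavesAt absentAt : ℕ → Vec Bool L → Vec Bool L → Bool
    leavesAt k a x = agree k x a ∧ not (agree (suc k) x a)
    absentAt k a x = not (agree (suc k) x a)

    -- PassesAt k u together with m(s) = a, as a conjunction of conditions on single nodes.
    nodeCondition : ℕ → Vec Bool L → ℕ → Vec Bool L → Bool
    nodeCondition k a = profile (toℕ s) (toℕ u) d (sameAs a) (leavesAt k a) (absentAt k a) (λ _ → true)

    Event : ℕ → Vec Bool L → Assignment n L → Bool
    Event k a = allAt (nodeCondition k a)

    Eventₛ : ℕ → Assignment n L → Bool
    Eventₛ k m = Event k (lookup m s) m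

    PassesAt⇒Eventₛ : ∀ m k → SearchFacts.PassesAt m s t k u → T (Eventₛ k m)
    PassesAt⇒Eventₛ m k (u∈k , u∉k+1 , gap) = allAt-intro _ m node
      where
      a = lookup m s
      node : ∀ i → T (nodeCondition k a (toℕ i) (lookup m i))
      node i = profile-intro (λ q → T (q (lookup m i))) (toℕ s) (toℕ u) d
        (sameAs a) (leavesAt k a) (absentAt k a) (λ _ → true) (toℕ i)
        (λ i≡s → subst (T ∘ sameAs a ∘ lookup m) (sym (toℕ-injective i≡s)) (agree-refl L a))
        (λ i≡u → subst (T ∘ leavesAt k a ∘ lookup m) (sym (toℕ-injective i≡u))
                       (Equivalence.from T-∧ (u∈k , ¬T⇒T-not u∉k+1)))
        (λ u<i i≤u+d → ¬T⇒T-not (gap i u<i (subst (toℕ i ≤_) u+d≡t i≤u+d)))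
        tt

    weight : ℕ → ℕ
    weight k = ∏< n (profile (toℕ s) (toℕ u) d 1 (X k) (Y k) M)

    count-Event : ∀ k a → k < L → count (Event k a) (allAssignments n L) ≡ weight k
    count-Event k a k<L = trans (count-allVecs (allBits L) n (nodeCondition k a))
      (∏-cong n (profile-map (λ q → count q (allBits L)) (toℕ s) (toℕ u) d
        (trans (count-agree L L a) (cong (2 ^_) (n∸n≡0 L)))
        (count-agree-exactly a k<L) (count-disagree a) (count-agree L 0 a)))

    count-Eventₛ : ∀ k → k < L → count (Eventₛ k) (allAssignments n L) ≤ M * weight k
    count-Eventₛ k k<L = begin
      count (Eventₛ k) (allAssignments n L)
        ≤⟨ count-union-bound (Eventₛ k) (allBits L) (Event k) (allAssignments n L)
             (λ m e → lookup m s , ∈-allBits _ , e) ⟩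
      ∑[ a ∈ allBits L ] count (Event k a) (allAssignments n L)  ≡⟨ ∑-cong (allBits L) (λ a → count-Event k a k<L) ⟩
      ∑[ a ∈ allBits L ] weight k                                ≡⟨ ∑-const (allBits L) _ ⟩
      length (allBits L) * weight k                              ≡⟨ cong (_* weight k) (length-allBits L) ⟩
      M * weight k                                               ∎
      where open ≤-Reasoning

    count-passes : countPasses n L s u t ≤ ∑[ k ∈ downFrom L ] M * weight k
    count-passes = begin
      countPasses n L s u t
        ≡⟨ length-filter-T? passes (allAssignments n L) ⟩
      count passes (allAssignments n L)
        ≤⟨ count-union-bound passes (downFrom L) Eventₛ (allAssignments n L) covered ⟩
      ∑[ k ∈ downFrom L ] count (Eventₛ k) (allAssignments n L)
        ≤⟨ ∑-mono (downFrom L) (λ k k∈ → count-Eventₛ k (∈-downFrom⁻ k∈)) ⟩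
      ∑[ k ∈ downFrom L ] M * weight k ∎
      where
      open ≤-Reasoning
      passes : Assignment n L → Bool
      passes m = Search.passesThrough m s t u
      covered : ∀ m → T (passes m) → ∃[ k ] k ∈ downFrom L × T (Eventₛ k m)
      covered m passes-m with SearchFacts.passes⇒PassesAt m s t u s<u passes-m
      ... | k , k<L , passesAt = k , ∈-downFrom⁺ k<L , PassesAt⇒Eventₛ m k passesAt

    weight-scaled : ∀ k → M * weight k * M ^ suc d ≡ M ^ n * (X k * Y k ^ d)
    weight-scaled k = begin
      M * weight k * M ^ suc d   ≡⟨ reassoc M (M ^ d) (weight k) ⟩
      weight k * M ^ (2 + d)     ≡⟨ ∏-profile n (toℕ s) (toℕ u) d 1 (X k) (Y k) M s<u u+d<n ⟩
      1 * X k * Y k ^ d * M ^ n  ≡⟨ reassoc′ (X k) (Y k ^ d) (M ^ n) ⟩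
      M ^ n * (X k * Y k ^ d)    ∎
      where
      open ≡-Reasoning
      u+d<n = subst (_< n) (sym u+d≡t) (toℕ<n t)
      reassoc : ∀ m p w → m * w * (m * p) ≡ w * (m * (m * p))
      reassoc = solve-∀
      reassoc′ : ∀ x y p → 1 * x * y * p ≡ p * (x * y)
      reassoc′ = solve-∀

    count-passes-scaled : countPasses n L s u t * M ^ suc d ≤ M ^ n * levelSum d
    count-passes-scaled = begin
      countPasses n L s u t * M ^ suc d                ≤⟨ *-monoˡ-≤ (M ^ suc d) count-passes ⟩
      (∑[ k ∈ downFrom L ] M * weight k) * M ^ suc d  ≡⟨ sym (∑-*ʳ (downFrom L) (M ^ suc d) _) ⟩
      ∑[ k ∈ downFrom L ] M * weight k * M ^ suc d    ≡⟨ ∑-cong (downFrom L) weight-scaled ⟩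
      ∑[ k ∈ downFrom L ] M ^ n * (X k * Y k ^ d)     ≡⟨ ∑-*ˡ (downFrom L) (M ^ n) _ ⟩
      M ^ n * levelSum d                               ∎
      where open ≤-Reasoning

    count-passes-bound : countPasses n L s u t * (suc d * 2 ^ d) ≤ (2 ^ suc d ∸ 1) * 2 ^ (n * L)
    count-passes-bound = begin
      countPasses n L s u t * (suc d * 2 ^ d)  ≤⟨ m+n≤o⇒m≤o∸n _ scaled ⟩
      2 ^ suc d * M ^ n ∸ M ^ n                ≡⟨ cong (2 ^ suc d * M ^ n ∸_) (sym (*-identityˡ (M ^ n))) ⟩
      2 ^ suc d * M ^ n ∸ 1 * M ^ n            ≡⟨ sym (*-distribʳ-∸ (M ^ n) (2 ^ suc d) 1) ⟩
      (2 ^ suc d ∸ 1) * M ^ n                  ≡⟨ cong ((2 ^ suc d ∸ 1) *_) M^n≡2^[nL] ⟩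
      (2 ^ suc d ∸ 1) * 2 ^ (n * L)            ∎
      where
      open ≤-Reasoning
      M^n≡2^[nL] : M ^ n ≡ 2 ^ (n * L)
      M^n≡2^[nL] = trans (^-*-assoc 2 L n) (cong (2 ^_) (*-comm L n))
      scaled : countPasses n L s u t * (suc d * 2 ^ d) + M ^ n ≤ 2 ^ suc d * M ^ n
      scaled = combine-bounds (countPasses n L s u t) (M ^ n) (levelSum d) (M ^ suc d) (suc d * 2 ^ d) (2 ^ suc d)
                 {{m^n≢0 M (suc d) {{m^n≢0 2 L}}}} count-passes-scaled (levelSum-bound d)

open PassingProbability using (module LevelEvents; +/<+/; +/1≤+/*+/1; pred-2^[1+d]-bound)
open import Data.Nat using (ℕ; suc; _*_; _^_; _∸_; NonZero)
open import Data.Nat.Properties using (m*n≢0; m^n≢0)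
open import Data.Fin using (Fin; toℕ; _<_)
open import Data.Integer using (+_)
open import Data.Rational using (ℚ; _/_) renaming (_<_ to _<ℚ_; _≤_ to _≤ℚ_; _*_ to _*ℚ_)
open import Data.Product using (∃; _×_; _,_)

theorem5 : (n : ℕ) (s u t : Fin n) → s < u → u < t →
    ∃ λ (q : ℚ) → (q <ℚ (+ 2 / suc (toℕ t ∸ toℕ u)))
      × ((L : ℕ) → (+ countPasses n L s u t / 1) ≤ℚ (q *ℚ (+ (2 ^ (n * L)) / 1)))
theorem5 n s u t s<u u<t = q , q<2/[d+1] , λ L →
  +/1≤+/*+/1 (countPasses n L s u t) (2 ^ suc d ∸ 1) B (2 ^ (n * L))
    (LevelEvents.count-passes-bound {n} {L} s u t s<u u<t)
  where
  d = toℕ t ∸ toℕ u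
  B = suc d * 2 ^ d
  instance
    B≢0 : NonZero B
    B≢0 = m*n≢0 (suc d) (2 ^ d) {{_}} {{m^n≢0 2 d}}
  -- q = 2/(d+1) - 1/((d+1) 2^d)
  q : ℚ
  q = + (2 ^ suc d ∸ 1) / B
  q<2/[d+1] : q <ℚ + 2 / suc d
  q<2/[d+1] = +/<+/ (2 ^ suc d ∸ 1) B 2 (suc d) (pred-2^[1+d]-bound d)
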